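{- For every finite set of formulas $\Gamma$ and every $\gamma$ that is a formula or empty: if $\Gamma\Rightarrow\gamma$ is derivable in $\mathrm{SLT}_{\omega}$ (with cut allowed), then $\Gamma\Rightarrow\gamma$, read as an $\mathrm{LT}_{\omega}$-sequent whose succedent is the set $\{\gamma\}$ or the empty set, is derivable in $\mathrm{LT}_{\omega}$.
   Context: Formulas are built from countably many propositional variables using binary $\to,\wedge,\vee$ and unary $\neg,\mathrm{G},\mathrm{F},\mathrm{X}$; $\mathrm{X}^0\alpha:=\alpha$, $\mathrm{X}^{n+1}\alpha:=\mathrm{X}^n\mathrm{X}\alpha$. $\Gamma,\Delta,\Sigma,\Pi$ denote finite sets of formulas; commas denote union. Derivations are well-founded, possibly infinitely branching trees. In all rules $i,k$ are arbitrary natural numbers, $p$ a propositional variable. $\mathrm{LT}_{\omega}$: sequents $\Gamma\Rightarrow\Delta$. Initial sequents $\mathrm{X}^ip\Rightarrow\mathrm{X}^ip$. Rules: (cut) from $\Gamma\Rightarrow\Delta,\alpha$ and $\alpha,\Sigma\Rightarrow\Pi$ infer $\Gamma,\Sigma\Rightarrow\Delta,\Pi$; (we-left) from $\Gamma\Rightarrow\Delta$ infer $\alpha,\Gamma\Rightarrow\Delta$; (we-right) from $\Gamma\Rightarrow\Delta$ infer $\Gamma\Rightarrow\Delta,\alpha$; ($\to$left) from $\Gamma\Rightarrow\Delta,\mathrm{X}^i\alpha$ and $\mathrm{X}^i\beta,\Gamma\Rightarrow\Delta$ infer $\mathrm{X}^i(\alpha\to\beta),\Gamma\Rightarrow\Delta$;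 ($\to$right) from $\mathrm{X}^i\alpha,\Gamma\Rightarrow\Delta,\mathrm{X}^i\beta$ infer $\Gamma\Rightarrow\Delta,\mathrm{X}^i(\alpha\to\beta)$; ($\neg$left) from $\Gamma\Rightarrow\Delta,\mathrm{X}^i\alpha$ infer $\mathrm{X}^i\neg\alpha,\Gamma\Rightarrow\Delta$; ($\neg$right) from $\mathrm{X}^i\alpha,\Gamma\Rightarrow\Delta$ infer $\Gamma\Rightarrow\Delta,\mathrm{X}^i\neg\alpha$; ($\wedge$left) from $\mathrm{X}^i\alpha,\mathrm{X}^i\beta,\Gamma\Rightarrow\Delta$ infer $\mathrm{X}^i(\alpha\wedge\beta),\Gamma\Rightarrow\Delta$; ($\wedge$right) from $\Gamma\Rightarrow\Delta,\mathrm{X}^i\alpha$ and $\Gamma\Rightarrow\Delta,\mathrm{X}^i\beta$ infer $\Gamma\Rightarrow\Delta,\mathrm{X}^i(\alpha\wedge\beta)$; ($\vee$left) from $\mathrm{X}^i\alpha,\Gamma\Rightarrow\Delta$ and $\mathrm{X}^i\beta,\Gamma\Rightarrow\Delta$ infer $\mathrm{X}^i(\alpha\vee\beta),\Gamma\Rightarrow\Delta$; ($\vee$right) from $\Gamma\Rightarrow\Delta,\mathrm{X}^i\alpha,\mathrm{X}^i\beta$ infer $\Gamma\Rightarrow\Delta,\mathrm{X}^i(\alpha\vee\beta)$; (Gleft) from $\mathrm{X}^{i+k}\alpha,\Gamma\Rightarrow\Delta$ infer $\mathrm{X}^i\mathrm{G}\alpha,\Gamma\Rightarrow\Delta$; (Gright)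 from all $\Gamma\Rightarrow\Delta,\mathrm{X}^{i+j}\alpha$ ($j\in\omega$) infer $\Gamma\Rightarrow\Delta,\mathrm{X}^i\mathrm{G}\alpha$; (Fleft) from all $\mathrm{X}^{i+j}\alpha,\Gamma\Rightarrow\Delta$ ($j\in\omega$) infer $\mathrm{X}^i\mathrm{F}\alpha,\Gamma\Rightarrow\Delta$; (Fright) from $\Gamma\Rightarrow\Delta,\mathrm{X}^{i+k}\alpha$ infer $\Gamma\Rightarrow\Delta,\mathrm{X}^i\mathrm{F}\alpha$. $\mathrm{SLT}_{\omega}$: sequents $\Gamma\Rightarrow\gamma$ with $\gamma$ a formula or empty. Initial sequents $\mathrm{X}^ip,\Gamma\Rightarrow\mathrm{X}^ip$. Rules: (cut) from $\Gamma\Rightarrow\alpha$ and $\alpha,\Sigma\Rightarrow\gamma$ infer $\Gamma,\Sigma\Rightarrow\gamma$; (we-right) from $\Gamma\Rightarrow$ infer $\Gamma\Rightarrow\alpha$; ($\to$left) from $\Gamma\Rightarrow\mathrm{X}^i\alpha$ and $\mathrm{X}^i\beta,\Gamma\Rightarrow\gamma$ infer $\mathrm{X}^i(\alpha\to\beta),\Gamma\Rightarrow\gamma$; ($\to$right) from $\mathrm{X}^i\alpha,\Gamma\Rightarrow\mathrm{X}^i\beta$ infer $\Gamma\Rightarrow\mathrm{X}^i(\alpha\to\beta)$; ($\neg$left) from $\Gamma\Rightarrow\mathrm{X}^i\alpha$ infer $\mathrm{X}^i\neg\alpha,\Gamma\Rightarrow$; ($\neg$right) from $\mathrm{X}^i\alpha,\Gamma\Rightarrow$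 infer $\Gamma\Rightarrow\mathrm{X}^i\neg\alpha$; (ex-middle) from $\mathrm{X}^i\neg\alpha,\Gamma\Rightarrow\gamma$ and $\mathrm{X}^i\alpha,\Gamma\Rightarrow\gamma$ infer $\Gamma\Rightarrow\gamma$; ($\wedge$left) from $\mathrm{X}^i\alpha,\mathrm{X}^i\beta,\Gamma\Rightarrow\gamma$ infer $\mathrm{X}^i(\alpha\wedge\beta),\Gamma\Rightarrow\gamma$; ($\wedge$right) from $\Gamma\Rightarrow\mathrm{X}^i\alpha$ and $\Gamma\Rightarrow\mathrm{X}^i\beta$ infer $\Gamma\Rightarrow\mathrm{X}^i(\alpha\wedge\beta)$; ($\vee$left) from $\mathrm{X}^i\alpha,\Gamma\Rightarrow\gamma$ and $\mathrm{X}^i\beta,\Gamma\Rightarrow\gamma$ infer $\mathrm{X}^i(\alpha\vee\beta),\Gamma\Rightarrow\gamma$; ($\vee$right1/2) from $\Gamma\Rightarrow\mathrm{X}^i\alpha$ (resp. $\Gamma\Rightarrow\mathrm{X}^i\beta$) infer $\Gamma\Rightarrow\mathrm{X}^i(\alpha\vee\beta)$; (Gleft) from $\mathrm{X}^{i+k}\alpha,\Gamma\Rightarrow\gamma$ infer $\mathrm{X}^i\mathrm{G}\alpha,\Gamma\Rightarrow\gamma$; (Gright) from all $\Gamma\Rightarrow\mathrm{X}^{i+j}\alpha$ ($j\in\omega$) infer $\Gamma\Rightarrow\mathrm{X}^i\mathrm{G}\alpha$; (Fleft) from all $\mathrm{X}^{i+j}\alpha,\Gamma\Rightarrow\gamma$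 ($j\in\omega$) infer $\mathrm{X}^i\mathrm{F}\alpha,\Gamma\Rightarrow\gamma$; (Fright) from $\Gamma\Rightarrow\mathrm{X}^{i+k}\alpha$ infer $\Gamma\Rightarrow\mathrm{X}^i\mathrm{F}\alpha$. -}

module Defs where

open import Data.Nat using (ℕ; zero; suc; _+_)
open import Data.List using (List; []; _∷_; _++_)
open import Data.Maybe using (Maybe; just; nothing)
open import Data.List.Relation.Binary.Subset.Propositional using (_⊆_)
open import Data.Product using (_×_)

infixr 5 _⇒_
infixr 6 _∨_
infixr 7 _∧_
data Fm : Set where
  var : ℕ → Fm
  _⇒_ _∧_ _∨_ : Fm → Fm → Fm
  ¬_ G F X : Fm → Fm

Xⁿ : ℕ → Fm → Fm
Xⁿ zero    α = α
Xⁿ (suc n) α = Xⁿ n (X α)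

-- Finite sets of formulas are represented by lists; two lists denote the
-- same set iff they have the same elements.
_≋_ : List Fm → List Fm → Set
Γ ≋ Δ = (Γ ⊆ Δ) × (Δ ⊆ Γ)

-- LT_ω : sequents Γ ⇒ Δ with Γ, Δ finite sets (lists up to ≋).
-- "Γ , α" (set union) is written α ∷ Γ; "Γ , Σ" is Γ ++ Σ.
data LT : List Fm → List Fm → Set where
  set-eq : ∀ {Γ Γ' Δ Δ'} → LT Γ Δ → Γ ≋ Γ' → Δ ≋ Δ' → LT Γ' Δ'
  init   : ∀ i p → LT (Xⁿ i (var p) ∷ []) (Xⁿ i (var p) ∷ [])
  cut    : ∀ {Γ Δ Σ Π} α → LT Γ (α ∷ Δ) → LT (α ∷ Σ) Π → LT (Γ ++ Σ) (Δ ++ Π)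
  we-l   : ∀ {Γ Δ} α → LT Γ Δ → LT (α ∷ Γ) Δ
  we-r   : ∀ {Γ Δ} α → LT Γ Δ → LT Γ (α ∷ Δ)
  ⇒l     : ∀ {Γ Δ} i α β → LT Γ (Xⁿ i α ∷ Δ) → LT (Xⁿ i β ∷ Γ) Δ → LT (Xⁿ i (α ⇒ β) ∷ Γ) Δ
  ⇒r     : ∀ {Γ Δ} i α β → LT (Xⁿ i α ∷ Γ) (Xⁿ i β ∷ Δ) → LT Γ (Xⁿ i (α ⇒ β) ∷ Δ)
  ¬l     : ∀ {Γ Δ} i α → LT Γ (Xⁿ i α ∷ Δ) → LT (Xⁿ i (¬ α) ∷ Γ) Δ
  ¬r     : ∀ {Γ Δ} i α → LT (Xⁿ i α ∷ Γ) Δ → LT Γ (Xⁿ i (¬ α) ∷ Δ)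
  ∧l     : ∀ {Γ Δ} i α β → LT (Xⁿ i α ∷ Xⁿ i β ∷ Γ) Δ → LT (Xⁿ i (α ∧ β) ∷ Γ) Δ
  ∧r     : ∀ {Γ Δ} i α β → LT Γ (Xⁿ i α ∷ Δ) → LT Γ (Xⁿ i β ∷ Δ) → LT Γ (Xⁿ i (α ∧ β) ∷ Δ)
  ∨l     : ∀ {Γ Δ} i α β → LT (Xⁿ i α ∷ Γ) Δ → LT (Xⁿ i β ∷ Γ) Δ → LT (Xⁿ i (α ∨ β) ∷ Γ) Δ
  ∨r     : ∀ {Γ Δ} i α β → LT Γ (Xⁿ i α ∷ Xⁿ i β ∷ Δ) → LT Γ (Xⁿ i (α ∨ β) ∷ Δ)
  Gl     : ∀ {Γ Δ} i k α → LT (Xⁿ (i + k) α ∷ Γ) Δ → LT (Xⁿ i (G α) ∷ Γ) Δ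
  Gr     : ∀ {Γ Δ} i α → (∀ j → LT Γ (Xⁿ (i + j) α ∷ Δ)) → LT Γ (Xⁿ i (G α) ∷ Δ)
  Fl     : ∀ {Γ Δ} i α → (∀ j → LT (Xⁿ (i + j) α ∷ Γ) Δ) → LT (Xⁿ i (F α) ∷ Γ) Δ
  Fr     : ∀ {Γ Δ} i k α → LT Γ (Xⁿ (i + k) α ∷ Δ) → LT Γ (Xⁿ i (F α) ∷ Δ)

-- SLT_ω : sequents Γ ⇒ γ with γ a formula (just γ) or empty (nothing).
data SLT : List Fm → Maybe Fm → Set where
  set-eq : ∀ {Γ Γ' γ} → SLT Γ γ → Γ ≋ Γ' → SLT Γ' γ
  init   : ∀ {Γ} i p → SLT (Xⁿ i (var p) ∷ Γ) (just (Xⁿ i (var p)))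
  cut    : ∀ {Γ Σ γ} α → SLT Γ (just α) → SLT (α ∷ Σ) γ → SLT (Γ ++ Σ) γ
  we-r   : ∀ {Γ} α → SLT Γ nothing → SLT Γ (just α)
  ⇒l     : ∀ {Γ γ} i α β → SLT Γ (just (Xⁿ i α)) → SLT (Xⁿ i β ∷ Γ) γ → SLT (Xⁿ i (α ⇒ β) ∷ Γ) γ
  ⇒r     : ∀ {Γ} i α β → SLT (Xⁿ i α ∷ Γ) (just (Xⁿ i β)) → SLT Γ (just (Xⁿ i (α ⇒ β)))
  ¬l     : ∀ {Γ} i α → SLT Γ (just (Xⁿ i α)) → SLT (Xⁿ i (¬ α) ∷ Γ) nothing
  ¬r     : ∀ {Γ} i α → SLT (Xⁿ i α ∷ Γ) nothing → SLT Γ (just (Xⁿ i (¬ α)))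
  ex-mid : ∀ {Γ γ} i α → SLT (Xⁿ i (¬ α) ∷ Γ) γ → SLT (Xⁿ i α ∷ Γ) γ → SLT Γ γ
  ∧l     : ∀ {Γ γ} i α β → SLT (Xⁿ i α ∷ Xⁿ i β ∷ Γ) γ → SLT (Xⁿ i (α ∧ β) ∷ Γ) γ
  ∧r     : ∀ {Γ} i α β → SLT Γ (just (Xⁿ i α)) → SLT Γ (just (Xⁿ i β)) → SLT Γ (just (Xⁿ i (α ∧ β)))
  ∨l     : ∀ {Γ γ} i α β → SLT (Xⁿ i α ∷ Γ) γ → SLT (Xⁿ i β ∷ Γ) γ → SLT (Xⁿ i (α ∨ β) ∷ Γ) γ
  ∨r1    : ∀ {Γ} i α β → SLT Γ (just (Xⁿ i α)) → SLT Γ (just (Xⁿ i (α ∨ β)))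
  ∨r2    : ∀ {Γ} i α β → SLT Γ (just (Xⁿ i β)) → SLT Γ (just (Xⁿ i (α ∨ β)))
  Gl     : ∀ {Γ γ} i k α → SLT (Xⁿ (i + k) α ∷ Γ) γ → SLT (Xⁿ i (G α) ∷ Γ) γ
  Gr     : ∀ {Γ} i α → (∀ j → SLT Γ (just (Xⁿ (i + j) α))) → SLT Γ (just (Xⁿ i (G α)))
  Fl     : ∀ {Γ γ} i α → (∀ j → SLT (Xⁿ (i + j) α ∷ Γ) γ) → SLT (Xⁿ i (F α) ∷ Γ) γ
  Fr     : ∀ {Γ} i k α → SLT Γ (just (Xⁿ (i + k) α)) → SLT Γ (just (Xⁿ i (F α)))

succ : Maybe Fm → List Fm
succ (just γ) = γ ∷ []
succ nothing  = []

{-# OPTIONS --safe #-}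
module Submission where

-- Every SLT_ω rule is an LT_ω rule up to weakening, except ex-middle: there
-- the premise Xⁱα, Γ ⇒ γ gives Γ ⇒ γ, Xⁱ¬α by (¬right), and a cut against the
-- other premise Xⁱ¬α, Γ ⇒ γ yields Γ, Γ ⇒ γ, γ, which is Γ ⇒ γ as sets.

open import Defs
open import Data.List using (List; []; _∷_; _++_)
open import Data.Maybe using (Maybe)
open import Data.Product using (_,_)
open import Data.Sum using ([_,_])
open import Function using (id)
open import Data.List.Relation.Binary.Subset.Propositional using (_⊆_)
open import Data.List.Relation.Binary.Subset.Propositional.Properties
  using (⊆-refl; xs⊆x∷xs; xs⊆xs++ys)
open import Data.List.Membership.Propositional.Properties using (∈-++⁺ˡ; ∈-++⁻)

≋-refl : ∀ {Γ} → Γ ≋ Γ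
≋-refl = ⊆-refl , ⊆-refl

++-absorbʳ : ∀ {Γ Γ'} → Γ ⊆ Γ' → (Γ' ++ Γ) ≋ Γ'
++-absorbʳ {Γ' = Γ'} Γ⊆Γ' = (λ x∈ → [ id , Γ⊆Γ' ] (∈-++⁻ Γ' x∈)) , ∈-++⁺ˡ

++-idem : ∀ {Γ} → (Γ ++ Γ) ≋ Γ
++-idem = ++-absorbʳ ⊆-refl

weakenˡ-++ : ∀ {Γ Δ} Σ → LT Γ Δ → LT (Σ ++ Γ) Δ
weakenˡ-++ []      d = d
weakenˡ-++ (α ∷ Σ) d = we-l α (weakenˡ-++ Σ d)

weakenʳ-++ : ∀ {Γ Δ} Π → LT Γ Δ → LT Γ (Π ++ Δ)
weakenʳ-++ []      d = d
weakenʳ-++ (α ∷ Π) d = we-r α (weakenʳ-++ Π d)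

weaken : ∀ {Γ Γ' Δ Δ'} → Γ ⊆ Γ' → Δ ⊆ Δ' → LT Γ Δ → LT Γ' Δ'
weaken {Γ' = Γ'} {Δ' = Δ'} Γ⊆Γ' Δ⊆Δ' d =
  set-eq (weakenʳ-++ Δ' (weakenˡ-++ Γ' d)) (++-absorbʳ Γ⊆Γ') (++-absorbʳ Δ⊆Δ')

excluded-middle : ∀ {Γ Δ} i α → LT (Xⁿ i (¬ α) ∷ Γ) Δ → LT (Xⁿ i α ∷ Γ) Δ → LT Γ Δ
excluded-middle i α d¬ d = set-eq (cut (Xⁿ i (¬ α)) (¬r i α d) d¬) ++-idem ++-idem

slt⇒lt : ∀ {Γ γ} → SLT Γ γ → LT Γ (succ γ)
slt⇒lt (set-eq d e)         = set-eq (slt⇒lt d) e ≋-refl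
slt⇒lt (init {Γ} i p)       = weaken (xs⊆xs++ys _ Γ) ⊆-refl (init i p)
slt⇒lt (cut α d e)          = cut α (slt⇒lt d) (slt⇒lt e)
slt⇒lt (we-r α d)           = we-r α (slt⇒lt d)
slt⇒lt (⇒l {γ = γ} i α β d e) =
  ⇒l i α β (weaken ⊆-refl (xs⊆xs++ys _ (succ γ)) (slt⇒lt d)) (slt⇒lt e)
slt⇒lt (⇒r i α β d)         = ⇒r i α β (slt⇒lt d)
slt⇒lt (¬l i α d)           = ¬l i α (slt⇒lt d)
slt⇒lt (¬r i α d)           = ¬r i α (slt⇒lt d)
slt⇒lt (ex-mid i α d¬ d)    = excluded-middle i α (slt⇒lt d¬) (slt⇒lt d)
slt⇒lt (∧l i α β d)         = ∧l i α β (slt⇒lt d)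
slt⇒lt (∧r i α β d e)       = ∧r i α β (slt⇒lt d) (slt⇒lt e)
slt⇒lt (∨l i α β d e)       = ∨l i α β (slt⇒lt d) (slt⇒lt e)
slt⇒lt (∨r1 i α β d)        = ∨r i α β (weaken ⊆-refl (xs⊆xs++ys _ _) (slt⇒lt d))
slt⇒lt (∨r2 i α β d)        = ∨r i α β (weaken ⊆-refl (xs⊆x∷xs _ _) (slt⇒lt d))
slt⇒lt (Gl i k α d)         = Gl i k α (slt⇒lt d)
slt⇒lt (Gr i α d)           = Gr i α (λ j → slt⇒lt (d j))
slt⇒lt (Fl i α d)           = Fl i α (λ j → slt⇒lt (d j))
slt⇒lt (Fr i k α d)         = Fr i k α (slt⇒lt d)

lemma2 : (Γ : List Fm) (γ : Maybe Fm) → SLT Γ γ → LT Γ (succ γ)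
lemma2 _ _ = slt⇒lt
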